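{- For all groups $G,H$, all $p\in\textsc{prop}$, all agents $i$ and all formulas $\phi,\psi$ of $\mathcal{RCD}$, the following are valid: (1) $R_Gp\leftrightarrow p$; (2) $R_G(\phi\wedge\psi)\leftrightarrow R_G\phi\wedge R_G\psi$; (3) $R_G\neg\phi\leftrightarrow\neg R_G\phi$; (4) $R_GK_i\phi\leftrightarrow D_GR_G\phi$, when $i\in G$; (5) $R_GK_i\phi\leftrightarrow K_iR_G\phi$, when $i\notin G$; (6) $R_GD_H\phi\leftrightarrow D_{G\cup H}R_G\phi$, when $G\cap H\neq\emptyset$; (7) $R_GD_H\phi\leftrightarrow D_HR_G\phi$, when $G\cap H=\emptyset$.
   Context: Fix a countable set $\textsc{prop}$ of propositional variables and a finite set $\textsc{ag}$ of agents; groups are nonempty subsets of $\textsc{ag}$. The language $\mathcal{RCD}$ is $\phi ::= p \mid \neg\phi \mid \phi\wedge\phi \mid K_i\phi \mid D_G\phi \mid C_G\phi \mid R_G\phi$. A model is $\mathfrak{M}=(S,\sim,V)$ with each $\sim_i$ an equivalence relation on $S$ and $V:\textsc{prop}\to 2^S$; $\sim_G=\bigcap_{i\in G}\sim_i$. The $G$-resolved update is $\mathfrak{M}|_G=(S,\sim|_G,V)$ with $(\sim|_G)_i=\sim_G$ for $i\in G$ and $\sim_i$ otherwise. Satisfaction: atoms via $V$; Booleans as usual; $K_i\phi$ at $s$ iff $\phi$ at all $t$ with $s\sim_it$; $D_G\phi$ iff $\phi$ at all $t$ with $s\sim_Gt$; $C_G\phi$ iff $\phi$ at all $t$ reachable from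 $s$ via the reflexive transitive closure of $\bigcup_{i\in G}\sim_i$; $\mathfrak{M},s\models R_G\phi$ iff $\mathfrak{M}|_G,s\models\phi$. Valid = true at every state of every model. -}

module Defs where

open import Data.Nat using (ℕ)
open import Data.Fin using (Fin)
open import Data.Fin.Subset using (Subset; _∈_; _∪_; Nonempty)
open import Data.Fin.Subset.Properties using (_∈?_; p⊆p∪q)
open import Data.Product using (_×_; _,_; Σ; proj₁; proj₂)
open import Relation.Nullary using (¬_; yes; no)
open import Relation.Binary using (IsEquivalence)
open import Relation.Binary.Construct.Closure.ReflexiveTransitive using (Star)

Prop : Set
Prop = ℕ

record Group (n : ℕ) : Set where
  constructor group
  field
    members  : Subset n
    nonempty : Nonempty members
open Group public

_∈G_ : ∀ {n} → Fin n → Group n → Set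
i ∈G G = i ∈ members G

_∪G_ : ∀ {n} → Group n → Group n → Group n
G ∪G H = group (members G ∪ members H)
               (proj₁ (nonempty G) , p⊆p∪q (members H) (proj₂ (nonempty G)))

data Form (n : ℕ) : Set where
  atom : Prop → Form n
  ¬'_  : Form n → Form n
  _∧'_ : Form n → Form n → Form n
  K    : Fin n → Form n → Form n
  D    : Group n → Form n → Form n
  C    : Group n → Form n → Form n
  R    : Group n → Form n → Form n

-- Underlying Kripke structure (S, ∼, V); validity below only quantifies over
-- those whose relations are equivalence relations (see Model).
record Structure (n : ℕ) : Set₁ where
  constructor structure
  field
    S   : Set
    rel : Fin n → S → S → Set
    V   : Prop → S → Set
open Structure public

relG : ∀ {n} (M : Structure n) → Group n → S M → S M → Set
relG M G s t = ∀ i → i ∈G G → rel M i s t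

relU : ∀ {n} (M : Structure n) → Group n → S M → S M → Set
relU M G s t = Σ (Fin _) λ i → i ∈G G × rel M i s t

update : ∀ {n} → Structure n → Group n → Structure n
update M G = structure (S M) rel' (V M)
  where
  rel' : Fin _ → S M → S M → Set
  rel' i with i ∈? members G
  ... | yes _ = relG M G
  ... | no  _ = rel M i

_,_⊨_ : ∀ {n} (M : Structure n) → S M → Form n → Set
M , s ⊨ atom p  = V M p s
M , s ⊨ (¬' φ)  = ¬ (M , s ⊨ φ)
M , s ⊨ (φ ∧' ψ) = (M , s ⊨ φ) × (M , s ⊨ ψ)
M , s ⊨ K i φ   = ∀ t → rel M i s t → M , t ⊨ φ
M , s ⊨ D G φ   = ∀ t → relG M G s t → M , t ⊨ φ
M , s ⊨ C G φ   = ∀ t → Star (relU M G) s t → M , t ⊨ φ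
M , s ⊨ R G φ   = update M G , s ⊨ φ

record Model (n : ℕ) : Set₁ where
  field
    structureOf : Structure n
    isEquiv     : ∀ i → IsEquivalence (rel structureOf i)
open Model public

ValidIff : ∀ {n} → Form n → Form n → Set₁
ValidIff {n} φ ψ = (M : Model n) (s : S (structureOf M)) →
  ((structureOf M , s ⊨ φ) → (structureOf M , s ⊨ ψ)) ×
  ((structureOf M , s ⊨ ψ) → (structureOf M , s ⊨ φ))

-- Every clause of R_G φ is evaluated in M|_G, which changes only the
-- accessibility relations, so atoms and Booleans commute with R_G and each
-- reduction axiom for a box modality amounts to an identity between relations:
-- in M|_G, agent i ∈ G sees along ∼_G, agent i ∉ G along ∼_i, and the
-- intersection over H of the updated relations is ∼_{G∪H} when some member of
-- H lies in G, and ∼_H otherwise. None of this needs the ∼_i to be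
-- equivalence relations.
module Submission where

open import Defs
open import Data.Nat using (ℕ)
open import Data.Fin using (Fin)
open import Data.Fin.Subset using (_∩_; _∉_; Nonempty; Empty)
open import Data.Fin.Subset.Properties using (_∈?_; p⊆p∪q; q⊆p∪q; x∈p∪q⁻; x∈p∩q⁺; x∈p∩q⁻)
open import Data.Product using (_×_; _,_; proj₁; proj₂)
open import Data.Sum using (inj₁; inj₂)
open import Function using (id)
open import Level using (Level)
open import Relation.Binary.Core using (Rel; _⇒_; _⇔_)
open import Relation.Nullary using (yes; no; contradiction)

module _ {a ℓ₁ ℓ₂ p : Level} {A : Set a} {R₁ : Rel A ℓ₁} {R₂ : Rel A ℓ₂} where

  □-resp-⇔ : R₁ ⇔ R₂ → {P : A → Set p} {s : A} →
             ((∀ t → R₁ s t → P t) → ∀ t → R₂ s t → P t) ×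
             ((∀ t → R₂ s t → P t) → ∀ t → R₁ s t → P t)
  □-resp-⇔ (R₁⇒R₂ , R₂⇒R₁) = (λ h t r → h t (R₂⇒R₁ r)) , (λ h t r → h t (R₁⇒R₂ r))

module _ {n : ℕ} (M : Structure n) (G : Group n) where

  update-rel-∈ : ∀ {i} → i ∈G G → rel (update M G) i ⇔ relG M G
  update-rel-∈ {i} i∈G with i ∈? members G
  ... | yes _   = id , id
  ... | no i∉G  = contradiction i∈G i∉G

  update-rel-∉ : ∀ {i} → i ∉ members G → rel (update M G) i ⇔ rel M i
  update-rel-∉ {i} i∉G with i ∈? members G
  ... | yes i∈G = contradiction i∈G i∉G
  ... | no _    = id , id

  update-rel-⊆ : ∀ {i} → rel (update M G) i ⇒ rel M i
  update-rel-⊆ {i} r with i ∈? members G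
  ... | yes i∈G = r i i∈G
  ... | no _    = r

  update-rel-⊇ : ∀ {i s t} → relG M G s t → rel M i s t → rel (update M G) i s t
  update-rel-⊇ {i} rG rᵢ with i ∈? members G
  ... | yes _ = rG
  ... | no _  = rᵢ

  update-relG-overlapping : ∀ {H} → Nonempty (members G ∩ members H) →
                            relG (update M G) H ⇔ relG M (G ∪G H)
  update-relG-overlapping {H} (j , j∈G∩H) = forward , backward
    where
    update-relG-⊆-relG : relG (update M G) H ⇒ relG M G
    update-relG-⊆-relG r with x∈p∩q⁻ (members G) (members H) j∈G∩H
    ... | j∈G , j∈H = proj₁ (update-rel-∈ j∈G) (r j j∈H)

    forward : relG (update M G) H ⇒ relG M (G ∪G H)
    forward r k k∈G∪H with x∈p∪q⁻ (members G) (members H) k∈G∪H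
    ... | inj₁ k∈G = update-relG-⊆-relG r k k∈G
    ... | inj₂ k∈H = update-rel-⊆ (r k k∈H)

    backward : relG M (G ∪G H) ⇒ relG (update M G) H
    backward r k k∈H = update-rel-⊇ (λ l l∈G → r l (p⊆p∪q (members H) l∈G))
                                    (r k (q⊆p∪q (members G) (members H) k∈H))

  update-relG-disjoint : ∀ {H} → Empty (members G ∩ members H) →
                         relG (update M G) H ⇔ relG M H
  update-relG-disjoint {H} G∩H≡∅ =
      (λ r k k∈H → proj₁ (update-rel-∉ (k∉G k∈H)) (r k k∈H))
    , (λ r k k∈H → proj₂ (update-rel-∉ (k∉G k∈H)) (r k k∈H))
    where
    k∉G : ∀ {k} → k ∈G H → k ∉ members G
    k∉G {k} k∈H k∈G = G∩H≡∅ (k , x∈p∩q⁺ (k∈G , k∈H))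

proposition2 : (n : ℕ) (G H : Group n) (p : Prop) (i : Fin n) (φ ψ : Form n) →
    ValidIff (R G (atom p)) (atom p)
    × ValidIff (R G (φ ∧' ψ)) (R G φ ∧' R G ψ)
    × ValidIff (R G (¬' φ)) (¬' (R G φ))
    × (i ∈G G → ValidIff (R G (K i φ)) (D G (R G φ)))
    × (i ∉ members G → ValidIff (R G (K i φ)) (K i (R G φ)))
    × (Nonempty (members G ∩ members H) → ValidIff (R G (D H φ)) (D (G ∪G H) (R G φ)))
    × (Empty (members G ∩ members H) → ValidIff (R G (D H φ)) (D H (R G φ)))
proposition2 n G H p i φ ψ =
    (λ _ _ → id , id)
  , (λ _ _ → id , id)
  , (λ _ _ → id , id)
  , (λ i∈G M _ → □-resp-⇔ (update-rel-∈ (structureOf M) G {i} i∈G))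
  , (λ i∉G M _ → □-resp-⇔ (update-rel-∉ (structureOf M) G {i} i∉G))
  , (λ G∩H≢∅ M _ → □-resp-⇔ (update-relG-overlapping (structureOf M) G {H} G∩H≢∅))
  , (λ G∩H≡∅ M _ → □-resp-⇔ (update-relG-disjoint (structureOf M) G {H} G∩H≡∅))
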